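{- Let $n\geq 0$ and $p\geq 0$. If $H$ is a maximal hypercube of dimension $p$ in the Fibonacci cube $\Gamma_n$, then its bottom vertex is $b(H)=0^n$ and its top vertex is $t(H)=0^{l_0}10^{l_1}\dots 10^{l_i}\dots10^{l_{p}}$ where $\sum_{i=0}^p l_i=n-p$, $0\leq l_0\leq 1$, $0\leq l_p\leq 1$, and $1\leq l_i\leq 2$ for $i=1,\dots,p-1$. Furthermore, any string of this form is the top vertex of a unique maximal hypercube of $\Gamma_n$.
   Context: $Q_n$ is the $n$-dimensional hypercube: vertices are binary strings of length $n$, two adjacent iff they differ in exactly one coordinate. A Fibonacci string of length $n$ is a binary string $b_1\dots b_n$ with $b_ib_{i+1}=0$ for $1\le i<n$; the Fibonacci cube $\Gamma_n$ ($n\ge1$) is the subgraph of $Q_n$ induced by the Fibonacci strings of length $n$, and $\Gamma_0=K_1$ (the empty string). The weight $w(u)$ of a string is its number of 1's. A hypercube of dimension $p$ in a graph $G$ (here $G=\Gamma_n$) is an induced subgraph of $G$ isomorphic to $Q_p$; it is maximal if there is no induced subgraph $H'$ of $G$ with $H\subset H'$ and $H'$ isomorphic to $Q_{p+1}$. For an induced subgraph $H$ of $Q_n$ isomorphic to $Q_k$ there is a unique vertex of minimal weight, the bottom vertex $b(H)$, and a unique vertex of maximal weight, the top vertex $t(H)$. The notation $0^l$ denotes a string of $l$ zeros. -}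

module Defs where

open import Data.Bool using (Bool; true; false; _∧_)
open import Data.Nat using (ℕ; zero; suc; _+_; _∸_; _≤_; _<_)
open import Data.Fin using (Fin; toℕ)
open import Data.Vec using (Vec; []; _∷_; head; last; lookup; toList)
import Data.Vec as V
open import Data.List using (List; _++_; concatMap)
import Data.List as L
open import Data.Unit using (⊤)
open import Data.Product using (Σ; Σ-syntax; _×_; ∃)
open import Function.Definitions using (Injective)
open import Function.Bundles using (_⇔_)
open import Relation.Binary.PropositionalEquality using (_≡_; _≢_)
open import Relation.Nullary using (¬_)

hamming : ∀ {n} → Vec Bool n → Vec Bool n → ℕ
hamming [] [] = 0
hamming (true ∷ u) (true ∷ v) = hamming u v
hamming (false ∷ u) (false ∷ v) = hamming u v
hamming (true ∷ u) (false ∷ v) = suc (hamming u v)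
hamming (false ∷ u) (true ∷ v) = suc (hamming u v)

Adj : ∀ {n} → Vec Bool n → Vec Bool n → Set
Adj u v = hamming u v ≡ 1

weight : ∀ {n} → Vec Bool n → ℕ
weight [] = 0
weight (true ∷ u) = suc (weight u)
weight (false ∷ u) = weight u

IsFib : ∀ {n} → Vec Bool n → Set
IsFib [] = ⊤
IsFib (b ∷ []) = ⊤
IsFib (b ∷ c ∷ u) = (b ∧ c ≡ false) × IsFib (c ∷ u)

-- A hypercube of dimension p in Γ_n: an induced subgraph of Γ_n isomorphic
-- to Q_p, given by an isomorphism from Q_p onto it (an injective map into
-- the Fibonacci strings that preserves and reflects adjacency).
record Cube (n p : ℕ) : Set where
  field
    embed     : Vec Bool p → Vec Bool n
    injective : Injective _≡_ _≡_ embed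
    fib       : ∀ x → IsFib (embed x)
    adj       : ∀ x y → Adj x y ⇔ Adj (embed x) (embed y)

open Cube public

_∈C_ : ∀ {n p} → Vec Bool n → Cube n p → Set
v ∈C H = ∃ λ x → embed H x ≡ v

Maximal : ∀ {n p} → Cube n p → Set
Maximal {n} {p} H = ¬ (Σ[ H' ∈ Cube n (suc p) ] (∀ v → v ∈C H → v ∈C H'))

IsBottom : ∀ {n p} → Cube n p → Vec Bool n → Set
IsBottom H v = v ∈C H × (∀ u → u ∈C H → u ≢ v → weight v < weight u)

IsTop : ∀ {n p} → Cube n p → Vec Bool n → Set
IsTop H v = v ∈C H × (∀ u → u ∈C H → u ≢ v → weight u < weight v)

SameCube : ∀ {n p q} → Cube n p → Cube n q → Set
SameCube {n} H H' = ∀ (v : Vec Bool n) → (v ∈C H) ⇔ (v ∈C H')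

topList : ∀ {p} → Vec ℕ (suc p) → List Bool
topList (l₀ ∷ ls) = L.replicate l₀ false ++ concatMap (λ k → true L.∷ L.replicate k false) (toList ls)

TopForm : (n p : ℕ) → Vec Bool n → Set
TopForm n p v = Σ[ l ∈ Vec ℕ (suc p) ]
  ( (V.sum l ≡ n ∸ p)
  × (head l ≤ 1)
  × (last l ≤ 1)
  × (∀ (i : Fin (suc p)) → 1 ≤ toℕ i → toℕ i < p → (1 ≤ lookup l i × lookup l i ≤ 2))
  × (toList v ≡ topList l) )

-- Every induced Q_p of Q_n is a subcube: the strings matching a pattern in
-- {0,1,∗}ⁿ with p stars. If such a cube lies in the down-closed set Γ_n and is
-- maximal, then freeing a fixed letter of its pattern must leave Γ_n; this
-- forces the pattern to have no fixed 1, so the cube is the down-set of its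
-- top t (and its bottom is 0ⁿ), and forces t to be a maximal Fibonacci
-- string. Conversely the down-set of a maximal Fibonacci string is a maximal
-- cube, the only one with that top. The maximal Fibonacci strings are exactly
-- the strings 0^{l₀}10^{l₁}…10^{l_p} with the stated bounds on the gaps: a
-- longer gap, or a border gap of 2, leaves room for another 1.

module Submission where

open import Defs
open import Data.Bool using (Bool; true; false; not; _∧_)
import Data.Bool as B
open import Data.Bool.Properties as BoolP using (≤-maximum; ≤-minimum; ∧-zeroʳ; not-¬; ¬-not)
open import Data.Empty using (⊥-elim)
open import Data.Fin using (Fin; toℕ)
import Data.Fin as Fin
open import Data.List using (List; []; _∷_; length; concatMap)
import Data.List as L
open import Data.List.Relation.Binary.Pointwise as ListPw using ([]; _∷_)
open import Data.Nat using (ℕ; zero; suc; _+_; _∸_; _≤_; _<_; z≤n; s≤s)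
open import Data.Nat.Properties
  using (module ≤-Reasoning; +-suc; m+n∸n≡m; ≤-refl; m≤n⇒m≤1+n; 1+n≰n; <-asym; suc-injective)
open import Data.Product using (Σ-syntax; ∃; ∃-syntax; _×_; _,_; proj₁; proj₂)
open import Data.Sum using (_⊎_; inj₁; inj₂)
import Data.Sum as Sum
open import Data.Unit using (⊤; tt)
open import Data.Vec using (Vec; []; _∷_; replicate; _++_; toList; fromList; lookup)
import Data.Vec as Vec
import Data.Vec.Properties as VecP
open import Data.Vec.Relation.Binary.Equality.Cast using (cast-is-id)
open import Data.Vec.Relation.Binary.Pointwise.Inductive as Pw using (Pointwise; []; _∷_)
open import Data.Vec.Relation.Unary.All using (All; []; _∷_)
open import Function using (_∘_; case_of_)
open import Function.Bundles using (Equivalence; mk⇔)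
open import Function.Definitions using (Injective)
open import Relation.Binary.PropositionalEquality
  using (_≡_; _≢_; refl; sym; trans; cong; subst; module ≡-Reasoning)
open import Relation.Nullary using (¬_; yes; no)
open import Relation.Unary using (Pred; _⊆_; _≐_; _∪_; _≬_)
open import Relation.Unary.Properties using (≬-sym)

private
  variable
    m n p q : ℕ

_⊑_ : Vec Bool n → Vec Bool n → Set
_⊑_ = Pointwise B._≤_

⊑-refl : {v : Vec Bool n} → v ⊑ v
⊑-refl = Pw.refl B.b≤b

⊑-trans : {u v w : Vec Bool n} → u ⊑ v → v ⊑ w → u ⊑ w
⊑-trans = Pw.trans BoolP.≤-trans

replicate-false-⊑ : (v : Vec Bool n) → replicate n false ⊑ v
replicate-false-⊑ [] = []
replicate-false-⊑ (b ∷ v) = ≤-minimum b ∷ replicate-false-⊑ v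

∧-false-mono : ∀ {a b c d} → a B.≤ c → b B.≤ d → c ∧ d ≡ false → a ∧ b ≡ false
∧-false-mono B.f≤t _ _ = refl
∧-false-mono {a} B.b≤b B.f≤t _ = ∧-zeroʳ a
∧-false-mono B.b≤b B.b≤b cd≡false = cd≡false

IsFib-⊑ : {u v : Vec Bool n} → u ⊑ v → IsFib v → IsFib u
IsFib-⊑ [] _ = tt
IsFib-⊑ (_ ∷ []) _ = tt
IsFib-⊑ (a≤c ∷ b≤d ∷ u⊑v) (cd≡false , fib) =
  ∧-false-mono a≤c b≤d cd≡false , IsFib-⊑ (b≤d ∷ u⊑v) fib

weight-mono : {u v : Vec Bool n} → u ⊑ v → weight u ≤ weight v
weight-mono [] = z≤n
weight-mono (B.f≤t ∷ u⊑v) = m≤n⇒m≤1+n (weight-mono u⊑v)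
weight-mono (B.b≤b {true} ∷ u⊑v) = s≤s (weight-mono u⊑v)
weight-mono (B.b≤b {false} ∷ u⊑v) = weight-mono u⊑v

weight-strict : {u v : Vec Bool n} → u ⊑ v → u ≢ v → weight u < weight v
weight-strict [] u≢v = ⊥-elim (u≢v refl)
weight-strict (B.f≤t ∷ u⊑v) _ = s≤s (weight-mono u⊑v)
weight-strict (B.b≤b {true} ∷ u⊑v) u≢v = s≤s (weight-strict u⊑v (u≢v ∘ cong (true ∷_)))
weight-strict (B.b≤b {false} ∷ u⊑v) u≢v = weight-strict u⊑v (u≢v ∘ cong (false ∷_))

hamming-refl : (v : Vec Bool n) → hamming v v ≡ 0
hamming-refl [] = refl
hamming-refl (true ∷ v) = hamming-refl v
hamming-refl (false ∷ v) = hamming-refl v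

hamming≡0⇒≡ : (u v : Vec Bool n) → hamming u v ≡ 0 → u ≡ v
hamming≡0⇒≡ [] [] _ = refl
hamming≡0⇒≡ (true ∷ u) (true ∷ v) h = cong (true ∷_) (hamming≡0⇒≡ u v h)
hamming≡0⇒≡ (false ∷ u) (false ∷ v) h = cong (false ∷_) (hamming≡0⇒≡ u v h)

Adj-∷ : ∀ b c (u v : Vec Bool n) → Adj (b ∷ u) (c ∷ v) → (b ≡ c × Adj u v) ⊎ (b ≢ c × u ≡ v)
Adj-∷ true true _ _ adj = inj₁ (refl , adj)
Adj-∷ false false _ _ adj = inj₁ (refl , adj)
Adj-∷ true false u v adj = inj₂ ((λ ()) , hamming≡0⇒≡ u v (suc-injective adj))
Adj-∷ false true u v adj = inj₂ ((λ ()) , hamming≡0⇒≡ u v (suc-injective adj))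

-- Subcubes and patterns

data Pat : Set where
  fix : Bool → Pat
  ∗   : Pat

data _∼_ : Pat → Bool → Set where
  fix∼ : ∀ {b} → fix b ∼ b
  ∗∼   : ∀ {b} → ∗ ∼ b

Matches : Vec Pat n → Pred (Vec Bool n) _
Matches = Pointwise _∼_

dim : Vec Pat n → ℕ
dim [] = 0
dim (fix _ ∷ P) = dim P
dim (∗ ∷ P) = suc (dim P)

⌈_⌉ : Pat → Bool
⌈ fix b ⌉ = b
⌈ ∗ ⌉ = true

top : Vec Pat n → Vec Bool n
top [] = []
top (x ∷ P) = ⌈ x ⌉ ∷ top P

∼⌈_⌉ : ∀ x → x ∼ ⌈ x ⌉
∼⌈ fix b ⌉ = fix∼
∼⌈ ∗ ⌉ = ∗∼

top-matches : (P : Vec Pat n) → Matches P (top P)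
top-matches [] = []
top-matches (x ∷ P) = ∼⌈ x ⌉ ∷ top-matches P

matches⇒⊑top : {P : Vec Pat n} {v : Vec Bool n} → Matches P v → v ⊑ top P
matches⇒⊑top [] = []
matches⇒⊑top (fix∼ ∷ m) = B.b≤b ∷ matches⇒⊑top m
matches⇒⊑top (∗∼ {b} ∷ m) = ≤-maximum b ∷ matches⇒⊑top m

dim-∷ : ∀ x {P Q : Vec Pat n} → dim P ≡ suc (dim Q) → dim (x ∷ P) ≡ suc (dim (x ∷ Q))
dim-∷ (fix _) e = e
dim-∷ ∗ e = cong suc e

dim≤weight-top : (P : Vec Pat n) → dim P ≤ weight (top P)
dim≤weight-top [] = z≤n
dim≤weight-top (fix true ∷ P) = m≤n⇒m≤1+n (dim≤weight-top P)
dim≤weight-top (fix false ∷ P) = dim≤weight-top P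
dim≤weight-top (∗ ∷ P) = s≤s (dim≤weight-top P)

fill : (P : Vec Pat n) → Vec Bool (dim P) → Vec Bool n
fill [] [] = []
fill (fix b ∷ P) x = b ∷ fill P x
fill (∗ ∷ P) (b ∷ x) = b ∷ fill P x

fill-injective : (P : Vec Pat n) → Injective _≡_ _≡_ (fill P)
fill-injective [] {[]} {[]} _ = refl
fill-injective (fix b ∷ P) e = fill-injective P (VecP.∷-injectiveʳ e)
fill-injective (∗ ∷ P) {b ∷ x} {c ∷ y} e with VecP.∷-injective e
... | refl , e′ = cong (b ∷_) (fill-injective P e′)

hamming-fill : (P : Vec Pat n) (x y : Vec Bool (dim P)) → hamming (fill P x) (fill P y) ≡ hamming x y
hamming-fill [] [] [] = refl
hamming-fill (fix true ∷ P) x y = hamming-fill P x y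
hamming-fill (fix false ∷ P) x y = hamming-fill P x y
hamming-fill (∗ ∷ P) (true ∷ x) (true ∷ y) = hamming-fill P x y
hamming-fill (∗ ∷ P) (false ∷ x) (false ∷ y) = hamming-fill P x y
hamming-fill (∗ ∷ P) (true ∷ x) (false ∷ y) = cong suc (hamming-fill P x y)
hamming-fill (∗ ∷ P) (false ∷ x) (true ∷ y) = cong suc (hamming-fill P x y)

fill-matches : (P : Vec Pat n) (x : Vec Bool (dim P)) → Matches P (fill P x)
fill-matches [] [] = []
fill-matches (fix b ∷ P) x = fix∼ ∷ fill-matches P x
fill-matches (∗ ∷ P) (b ∷ x) = ∗∼ ∷ fill-matches P x

matches⇒fill : {P : Vec Pat n} {v : Vec Bool n} → Matches P v → ∃ λ x → fill P x ≡ v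
matches⇒fill [] = [] , refl
matches⇒fill (fix∼ {b} ∷ m) = let x , e = matches⇒fill m in x , cong (b ∷_) e
matches⇒fill (∗∼ {b} ∷ m) = let x , e = matches⇒fill m in b ∷ x , cong (b ∷_) e

pattern-cube : (P : Vec Pat n) → dim P ≡ q → Matches P ⊆ IsFib →
          Σ[ H ∈ Cube n q ] (_∈C H) ≐ Matches P
pattern-cube {n} P refl P-fib = H , (λ { (x , refl) → fill-matches P x }) , matches⇒fill
  where
  H : Cube n (dim P)
  H = record
    { embed = fill P
    ; injective = fill-injective P
    ; fib = P-fib ∘ fill-matches P
    ; adj = λ x y → mk⇔ (trans (hamming-fill P x y)) (trans (sym (hamming-fill P x y)))
    }

∈C-fib : {H : Cube n p} → (_∈C H) ⊆ IsFib
∈C-fib {H = H} (x , refl) = fib H x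

-- Every hypercube of Q_n is spanned by a pattern

Covers : Pred (Vec Bool n) _ → Pred (Vec Bool n) _ → Set
Covers A B = ∀ {a} → A a → ∃[ b ] B b × Adj a b

Merge : Vec Pat n → Vec Pat n → Set
Merge {n} P₀ P₁ = Σ[ P ∈ Vec Pat n ] dim P ≡ suc (dim P₀) × Matches P ≐ Matches P₀ ∪ Matches P₁

merge-∷ : ∀ x {P₀ P₁ : Vec Pat n} → Merge P₀ P₁ → Merge (x ∷ P₀) (x ∷ P₁)
merge-∷ x (P , dimP , P⊆ , ⊆P) = x ∷ P , dim-∷ x dimP , split , join
  where
  split : Matches (x ∷ P) ⊆ Matches (x ∷ _) ∪ Matches (x ∷ _)
  split (h ∷ m) = Sum.map (h ∷_) (h ∷_) (P⊆ m)
  join : Matches (x ∷ _) ∪ Matches (x ∷ _) ⊆ Matches (x ∷ P)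
  join (inj₁ (h ∷ m)) = h ∷ ⊆P (inj₁ m)
  join (inj₂ (h ∷ m)) = h ∷ ⊆P (inj₂ m)

module _ {Q₀ Q₁ : Vec Pat n} where

  disjoint-tail : ∀ x → ¬ (Matches (x ∷ Q₀) ≬ Matches (x ∷ Q₁)) → ¬ (Matches Q₀ ≬ Matches Q₁)
  disjoint-tail x disj (v , m₀ , m₁) = disj (⌈ x ⌉ ∷ v , ∼⌈ x ⌉ ∷ m₀ , ∼⌈ x ⌉ ∷ m₁)

  covers-tail : ∀ {x} → ¬ (Matches Q₀ ≬ Matches Q₁) →
                Covers (Matches (x ∷ Q₀)) (Matches (x ∷ Q₁)) → Covers (Matches Q₀) (Matches Q₁)
  covers-tail {x} disj cov {a} m₀ with cov (∼⌈ x ⌉ ∷ m₀)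
  ... | h ∷ b , _ ∷ m₁ , adj with Adj-∷ ⌈ x ⌉ h a b adj
  ...   | inj₁ (_ , adj′) = b , m₁ , adj′
  ...   | inj₂ (_ , refl) = ⊥-elim (disj (_ , m₀ , m₁))

  covers-conflict : ∀ {b c} → b ≢ c →
                    Covers (Matches (fix b ∷ Q₀)) (Matches (fix c ∷ Q₁)) → Matches Q₀ ⊆ Matches Q₁
  covers-conflict {b} {c} b≢c cov {a} m₀ with cov (fix∼ ∷ m₀)
  ... | _ ∷ v , fix∼ ∷ m₁ , adj with Adj-∷ b c a v adj
  ...   | inj₁ (b≡c , _) = ⊥-elim (b≢c b≡c)
  ...   | inj₂ (_ , refl) = m₁

  -- The only possible neighbour of (not b ∷ v) in the fixed half is
  -- (b ∷ v), which lies in the free half as well.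
  fix-∗-incompatible : ∀ {b} → ¬ (Matches (fix b ∷ Q₀) ≬ Matches (∗ ∷ Q₁)) →
                       ¬ Covers (Matches (∗ ∷ Q₁)) (Matches (fix b ∷ Q₀))
  fix-∗-incompatible {b} disj cov with cov (∗∼ {not b} ∷ top-matches Q₁)
  ... | _ ∷ a , fix∼ ∷ m₀ , adj with Adj-∷ (not b) b (top Q₁) a adj
  ...   | inj₁ (nb≡b , _) = not-¬ refl (sym nb≡b)
  ...   | inj₂ (_ , refl) = disj (_ , fix∼ ∷ m₀ , ∗∼ ∷ top-matches Q₁)

-- The halves of a cube span patterns that agree except at one position,
-- fixed to 0 in one and to 1 in the other; that position becomes ∗.
merge : (P₀ P₁ : Vec Pat n) → ¬ (Matches P₀ ≬ Matches P₁) →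
        Covers (Matches P₀) (Matches P₁) → Covers (Matches P₁) (Matches P₀) → Merge P₀ P₁

merge-tails : ∀ x {Q₀ Q₁ : Vec Pat n} → ¬ (Matches (x ∷ Q₀) ≬ Matches (x ∷ Q₁)) →
              Covers (Matches (x ∷ Q₀)) (Matches (x ∷ Q₁)) →
              Covers (Matches (x ∷ Q₁)) (Matches (x ∷ Q₀)) → Merge Q₀ Q₁
merge-tails x {Q₀} {Q₁} disj c₀₁ c₁₀ =
  merge Q₀ Q₁ disj′ (covers-tail disj′ c₀₁) (covers-tail (disj′ ∘ ≬-sym) c₁₀)
  where disj′ = disjoint-tail x disj

merge [] [] disj _ _ = ⊥-elim (disj ([] , [] , []))
merge (fix b ∷ Q₀) (fix c ∷ Q₁) disj c₀₁ c₁₀ with b B.≟ c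
... | yes refl = merge-∷ (fix b) (merge-tails (fix b) disj c₀₁ c₁₀)
... | no b≢c = ∗ ∷ Q₀ , refl , split , join
  where
  split : Matches (∗ ∷ Q₀) ⊆ Matches (fix b ∷ Q₀) ∪ Matches (fix c ∷ Q₁)
  split (∗∼ {h} ∷ m) with h B.≟ b
  ... | yes refl = inj₁ (fix∼ ∷ m)
  ... | no h≢b with trans (¬-not h≢b) (sym (¬-not (b≢c ∘ sym)))
  ...   | refl = inj₂ (fix∼ ∷ covers-conflict b≢c c₀₁ m)
  join : Matches (fix b ∷ Q₀) ∪ Matches (fix c ∷ Q₁) ⊆ Matches (∗ ∷ Q₀)
  join (inj₁ (_ ∷ m)) = ∗∼ ∷ m
  join (inj₂ (_ ∷ m)) = ∗∼ ∷ covers-conflict (b≢c ∘ sym) c₁₀ m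
merge (∗ ∷ Q₀) (∗ ∷ Q₁) disj c₀₁ c₁₀ = merge-∷ ∗ (merge-tails ∗ disj c₀₁ c₁₀)
merge (fix b ∷ Q₀) (∗ ∷ Q₁) disj c₀₁ c₁₀ = ⊥-elim (fix-∗-incompatible disj c₁₀)
merge (∗ ∷ Q₀) (fix c ∷ Q₁) disj c₀₁ c₁₀ = ⊥-elim (fix-∗-incompatible (disj ∘ ≬-sym) c₀₁)

Image : (Vec Bool p → Vec Bool n) → Pred (Vec Bool n) _
Image f v = ∃ λ x → f x ≡ v

matches-fix⇒≡ : {u v : Vec Bool n} → Matches (Vec.map fix u) v → v ≡ u
matches-fix⇒≡ {u = []} [] = refl
matches-fix⇒≡ {u = _ ∷ _} (fix∼ ∷ m) = cong (_ ∷_) (matches-fix⇒≡ m)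

fix-matches : (u : Vec Bool n) → Matches (Vec.map fix u) u
fix-matches [] = []
fix-matches (_ ∷ u) = fix∼ ∷ fix-matches u

dim-fix : (u : Vec Bool n) → dim (Vec.map fix u) ≡ 0
dim-fix [] = refl
dim-fix (_ ∷ u) = dim-fix u

embedding-pattern : ∀ p (f : Vec Bool p → Vec Bool n) → Injective _≡_ _≡_ f →
                    (∀ x y → Adj x y → Adj (f x) (f y)) →
                    ∃[ P ] dim P ≡ p × Matches P ≐ Image f
embedding-pattern zero f _ _ =
  P , dim-fix (f []) , (λ m → [] , sym (matches-fix⇒≡ m)) , λ { ([] , refl) → fix-matches (f []) }
  where P = Vec.map fix (f [])
embedding-pattern (suc p) f inj adj
  with embedding-pattern p (f ∘ (false ∷_)) (VecP.∷-injectiveʳ ∘ inj) (λ x y → adj (false ∷ x) (false ∷ y))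
     | embedding-pattern p (f ∘ (true ∷_)) (VecP.∷-injectiveʳ ∘ inj) (λ x y → adj (true ∷ x) (true ∷ y))
... | P₀ , refl , P₀⊆ , ⊆P₀ | P₁ , _ , P₁⊆ , ⊆P₁ with merge P₀ P₁ disjoint covers₀₁ covers₁₀
  where
  disjoint : ¬ (Matches P₀ ≬ Matches P₁)
  disjoint (v , m₀ , m₁) with P₀⊆ m₀ | P₁⊆ m₁
  ... | x , refl | y , e = case inj (sym e) of λ ()
  covers₀₁ : Covers (Matches P₀) (Matches P₁)
  covers₀₁ m₀ with P₀⊆ m₀
  ... | x , refl = f (true ∷ x) , ⊆P₁ (x , refl) , adj (false ∷ x) (true ∷ x) (cong suc (hamming-refl x))
  covers₁₀ : Covers (Matches P₁) (Matches P₀)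
  covers₁₀ m₁ with P₁⊆ m₁
  ... | x , refl = f (false ∷ x) , ⊆P₀ (x , refl) , adj (true ∷ x) (false ∷ x) (cong suc (hamming-refl x))
... | P , dimP , split , join = P , dimP , P⊆ , ⊆P
  where
  P⊆ : Matches P ⊆ Image f
  P⊆ m with split m
  ... | inj₁ m₀ = let x , e = P₀⊆ m₀ in false ∷ x , e
  ... | inj₂ m₁ = let x , e = P₁⊆ m₁ in true ∷ x , e
  ⊆P : Image f ⊆ Matches P
  ⊆P (false ∷ x , refl) = join (inj₁ (⊆P₀ (x , refl)))
  ⊆P (true ∷ x , refl) = join (inj₂ (⊆P₁ (x , refl)))

cube-pattern : (H : Cube n p) → ∃[ P ] dim P ≡ p × Matches P ≐ (_∈C H)
cube-pattern H = embedding-pattern _ (embed H) (injective H) (λ x y → Equivalence.to (adj H x y))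

-- Maximal hypercubes of Γ_n

data Low : Pat → Set where
  fix-false : Low (fix false)
  free      : Low ∗

⊑top⇒matches : {P : Vec Pat n} {v : Vec Bool n} → All Low P → v ⊑ top P → Matches P v
⊑top⇒matches [] [] = []
⊑top⇒matches (fix-false ∷ low) (B.b≤b ∷ v⊑) = fix∼ ∷ ⊑top⇒matches low v⊑
⊑top⇒matches (free ∷ low) (_ ∷ v⊑) = ∗∼ ∷ ⊑top⇒matches low v⊑

weight-top : {P : Vec Pat n} → All Low P → weight (top P) ≡ dim P
weight-top [] = refl
weight-top (fix-false ∷ low) = weight-top low
weight-top (free ∷ low) = cong suc (weight-top low)

MaximalFib : Vec Bool n → Set
MaximalFib t = ∀ v → IsFib v → t ⊑ v → v ≡ t

FreeingBelow : Vec Pat n → Vec Bool n → Set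
FreeingBelow {n} P v =
  Σ[ P′ ∈ Vec Pat n ] dim P′ ≡ suc (dim P) × Matches P ⊆ Matches P′ × top P′ ⊑ v

freeing-∷ : ∀ x {h} {P : Vec Pat n} {v} → ⌈ x ⌉ B.≤ h → FreeingBelow P v → FreeingBelow (x ∷ P) (h ∷ v)
freeing-∷ x x≤h (P′ , dimP′ , P⊆P′ , top⊑v) =
  x ∷ P′ , dim-∷ x dimP′ , (λ { (a ∷ m) → a ∷ P⊆P′ m }) , x≤h ∷ top⊑v

freeing-head : ∀ {b} (P : Vec Pat n) {v} → top P ⊑ v → FreeingBelow (fix b ∷ P) (true ∷ v)
freeing-head P top⊑v = ∗ ∷ P , refl , (λ { (fix∼ ∷ m) → ∗∼ ∷ m }) , B.b≤b ∷ top⊑v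

-- The freed letter is a fixed 1, or a fixed 0 that is a 1 in v.
low-or-freeing : (P : Vec Pat n) {v : Vec Bool n} → top P ⊑ v → (All Low P × v ≡ top P) ⊎ FreeingBelow P v
low-or-freeing [] [] = inj₁ ([] , refl)
low-or-freeing (fix true ∷ P) (B.b≤b ∷ top⊑v) = inj₂ (freeing-head P top⊑v)
low-or-freeing (fix false ∷ P) (B.f≤t ∷ top⊑v) = inj₂ (freeing-head P top⊑v)
low-or-freeing (fix false ∷ P) (B.b≤b ∷ top⊑v) =
  Sum.map (λ (low , e) → fix-false ∷ low , cong (false ∷_) e) (freeing-∷ (fix false) B.b≤b)
          (low-or-freeing P top⊑v)
low-or-freeing (∗ ∷ P) (B.b≤b ∷ top⊑v) =
  Sum.map (λ (low , e) → free ∷ low , cong (true ∷_) e) (freeing-∷ ∗ B.b≤b) (low-or-freeing P top⊑v)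

maximal-pattern : (H : Cube n p) → Maximal H → (P : Vec Pat n) → dim P ≡ p → Matches P ≐ (_∈C H) →
                  All Low P × MaximalFib (top P)
maximal-pattern H maximal P dimP (P⊆H , H⊆P) =
  proj₁ (above-top (top P) (∈C-fib {H = H} (P⊆H (top-matches P))) ⊑-refl) ,
  λ v fib top⊑v → proj₂ (above-top v fib top⊑v)
  where
  above-top : ∀ v → IsFib v → top P ⊑ v → All Low P × v ≡ top P
  above-top v fib top⊑v with low-or-freeing P top⊑v
  ... | inj₁ r = r
  ... | inj₂ (P′ , dimP′ , P⊆P′ , top′⊑v) = ⊥-elim (maximal (H′ , λ _ → ⊆H′ ∘ P⊆P′ ∘ H⊆P))
    where
    spanned = pattern-cube P′ (trans dimP′ (cong suc dimP))
                           (λ m → IsFib-⊑ (⊑-trans (matches⇒⊑top m) top′⊑v) fib)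
    H′ = proj₁ spanned
    ⊆H′ = proj₂ (proj₂ spanned)

maximal-cube-downset : (H : Cube n p) → Maximal H →
                       ∃[ t ] IsFib t × weight t ≡ p × MaximalFib t × (_∈C H) ≐ (_⊑ t)
maximal-cube-downset H maximal with cube-pattern H
... | P , dimP , P⊆H , H⊆P with maximal-pattern H maximal P dimP (P⊆H , H⊆P)
... | low , top-maximal =
  top P , ∈C-fib {H = H} (P⊆H (top-matches P)) , trans (weight-top low) dimP , top-maximal ,
  matches⇒⊑top ∘ H⊆P , P⊆H ∘ ⊑top⇒matches low

freeOnes : Vec Bool n → Vec Pat n
freeOnes [] = []
freeOnes (true ∷ t) = ∗ ∷ freeOnes t
freeOnes (false ∷ t) = fix false ∷ freeOnes t

freeOnes-low : (t : Vec Bool n) → All Low (freeOnes t)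
freeOnes-low [] = []
freeOnes-low (true ∷ t) = free ∷ freeOnes-low t
freeOnes-low (false ∷ t) = fix-false ∷ freeOnes-low t

top-freeOnes : (t : Vec Bool n) → top (freeOnes t) ≡ t
top-freeOnes [] = refl
top-freeOnes (true ∷ t) = cong (true ∷_) (top-freeOnes t)
top-freeOnes (false ∷ t) = cong (false ∷_) (top-freeOnes t)

downset-cube : (t : Vec Bool n) → IsFib t → weight t ≡ q → Σ[ H ∈ Cube n q ] (_∈C H) ≐ (_⊑ t)
downset-cube {q = q} t t-fib weight≡q =
  H , below-t ∘ H⊆ , ⊆H ∘ ⊑top⇒matches (freeOnes-low t) ∘ subst (_ ⊑_) (sym (top-freeOnes t))
  where
  below-t : Matches (freeOnes t) ⊆ (_⊑ t)
  below-t m = subst (_ ⊑_) (top-freeOnes t) (matches⇒⊑top m)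
  dim≡q : dim (freeOnes t) ≡ q
  dim≡q = trans (sym (weight-top (freeOnes-low t))) (trans (cong weight (top-freeOnes t)) weight≡q)
  spanned = pattern-cube (freeOnes t) dim≡q (λ m → IsFib-⊑ (below-t m) t-fib)
  H = proj₁ spanned
  H⊆ = proj₁ (proj₂ spanned)
  ⊆H = proj₂ (proj₂ spanned)

downset-maximal : {t : Vec Bool n} → MaximalFib t → weight t ≡ p →
                  (H : Cube n p) → (_∈C H) ≐ (_⊑ t) → Maximal H
downset-maximal {n} {p} {t} t-maximal weight≡p H (_ , ⊆H) (H′ , H⊆H′) with cube-pattern H′
... | P′ , dimP′ , P′⊆H′ , H′⊆P′ = 1+n≰n (begin
  suc p             ≡⟨ sym dimP′ ⟩
  dim P′            ≤⟨ dim≤weight-top P′ ⟩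
  weight (top P′)   ≡⟨ cong weight top≡t ⟩
  weight t          ≡⟨ weight≡p ⟩
  p                 ∎)
  where
  open ≤-Reasoning
  top≡t : top P′ ≡ t
  top≡t = t-maximal (top P′) (∈C-fib {H = H′} (P′⊆H′ (top-matches P′)))
                    (matches⇒⊑top (H′⊆P′ (H⊆H′ t (⊆H ⊑-refl))))

downset-IsTop : (H : Cube n p) {t : Vec Bool n} → (_∈C H) ≐ (_⊑ t) → IsTop H t
downset-IsTop _ (H⊆ , ⊆H) = ⊆H ⊑-refl , λ _ u∈H u≢t → weight-strict (H⊆ u∈H) u≢t

downset-IsBottom : (H : Cube n p) {t : Vec Bool n} → (_∈C H) ≐ (_⊑ t) → IsBottom H (replicate n false)
downset-IsBottom _ {t} (_ , ⊆H) =
  ⊆H (replicate-false-⊑ t) , λ u _ u≢0 → weight-strict (replicate-false-⊑ u) (u≢0 ∘ sym)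

IsTop-unique : (H : Cube n p) {t t′ : Vec Bool n} → IsTop H t → IsTop H t′ → t ≡ t′
IsTop-unique _ {t} {t′} (t∈H , below-t) (t′∈H , below-t′) with VecP.≡-dec B._≟_ t t′
... | yes t≡t′ = t≡t′
... | no t≢t′ = ⊥-elim (<-asym (below-t′ t t∈H t≢t′) (below-t t′ t′∈H (t≢t′ ∘ sym)))

-- Maximal Fibonacci strings

blocks : List ℕ → List Bool
blocks = concatMap (λ k → true ∷ L.replicate k false)

gapString : ℕ → List ℕ → List Bool
gapString l₀ ks = L.replicate l₀ false L.++ blocks ks

Gaps : List ℕ → Set
Gaps [] = ⊤
Gaps (k ∷ []) = k ≤ 1
Gaps (k ∷ ks@(_ ∷ _)) = (1 ≤ k × k ≤ 2) × Gaps ks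

GapForm : Vec Bool n → Set
GapForm t = Σ[ l₀ ∈ ℕ ] Σ[ ks ∈ List ℕ ] l₀ ≤ 1 × Gaps ks × toList t ≡ gapString l₀ ks

TailForm : Vec Bool n → Set
TailForm w = Σ[ k ∈ ℕ ] Σ[ ks ∈ List ℕ ] Gaps (k ∷ ks) × toList w ≡ gapString k ks

Enlargeable : Vec Bool n → Set
Enlargeable {n} t = Σ[ v ∈ Vec Bool n ] IsFib v × t ⊑ v × v ≢ t

enlargeable-prefix : (u : Vec Bool m) {w : Vec Bool n} →
                     (∀ {v : Vec Bool n} → IsFib (true ∷ v) → IsFib (u ++ true ∷ v)) →
                     Enlargeable (true ∷ w) → Enlargeable (u ++ true ∷ w)
enlargeable-prefix u lift (_ ∷ v , fib , B.b≤b ∷ w⊑v , v≢w) =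
  u ++ true ∷ v , lift fib , Pw.++⁺ ⊑-refl (B.b≤b ∷ w⊑v) , v≢w ∘ VecP.++-injectiveʳ u u

tailForm-or-enlargeable : (w : Vec Bool n) → IsFib (true ∷ w) → TailForm w ⊎ Enlargeable (true ∷ w)
tailForm-or-enlargeable [] _ = inj₁ (0 , [] , z≤n , refl)
tailForm-or-enlargeable (true ∷ _) (() , _)
tailForm-or-enlargeable (false ∷ []) _ = inj₁ (1 , [] , ≤-refl , refl)
tailForm-or-enlargeable (false ∷ true ∷ w) (_ , _ , fib) =
  Sum.map (λ (k , ks , gaps , e) →
             1 , k ∷ ks , ((≤-refl , s≤s z≤n) , gaps) , cong (λ z → false ∷ true ∷ z) e)
          (enlargeable-prefix (true ∷ false ∷ []) (λ fib → refl , refl , fib))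
          (tailForm-or-enlargeable w fib)
tailForm-or-enlargeable (false ∷ false ∷ []) _ =
  inj₂ (true ∷ false ∷ true ∷ [] , (refl , refl , tt) , B.b≤b ∷ B.b≤b ∷ B.f≤t ∷ [] , λ ())
tailForm-or-enlargeable (false ∷ false ∷ true ∷ w) (_ , _ , _ , fib) =
  Sum.map (λ (k , ks , gaps , e) →
             2 , k ∷ ks , ((s≤s z≤n , ≤-refl) , gaps) , cong (λ z → false ∷ false ∷ true ∷ z) e)
          (enlargeable-prefix (true ∷ false ∷ false ∷ []) (λ fib → refl , refl , refl , fib))
          (tailForm-or-enlargeable w fib)
tailForm-or-enlargeable (false ∷ false ∷ false ∷ w) (_ , _ , _ , fib) =
  inj₂ (true ∷ false ∷ true ∷ false ∷ w , (refl , refl , refl , fib) ,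
        B.b≤b ∷ B.b≤b ∷ B.f≤t ∷ ⊑-refl , λ ())

gapForm-or-enlargeable : (t : Vec Bool n) → IsFib t → GapForm t ⊎ Enlargeable t
gapForm-or-enlargeable [] _ = inj₁ (0 , [] , z≤n , tt , refl)
gapForm-or-enlargeable (true ∷ w) fib =
  Sum.map₁ (λ (k , ks , gaps , e) → 0 , k ∷ ks , z≤n , gaps , cong (true ∷_) e) (tailForm-or-enlargeable w fib)
gapForm-or-enlargeable (false ∷ []) _ = inj₂ (true ∷ [] , tt , B.f≤t ∷ [] , λ ())
gapForm-or-enlargeable (false ∷ true ∷ w) (_ , fib) =
  Sum.map (λ (k , ks , gaps , e) → 1 , k ∷ ks , ≤-refl , gaps , cong (λ z → false ∷ true ∷ z) e)
          (enlargeable-prefix (false ∷ []) (λ fib → refl , fib))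
          (tailForm-or-enlargeable w fib)
gapForm-or-enlargeable (false ∷ false ∷ w) (_ , fib) =
  inj₂ (true ∷ false ∷ w , (refl , fib) , B.f≤t ∷ ⊑-refl , λ ())

_⊑ᴸ_ : List Bool → List Bool → Set
_⊑ᴸ_ = ListPw.Pointwise B._≤_

toList-⊑ : {u v : Vec Bool n} → u ⊑ v → toList u ⊑ᴸ toList v
toList-⊑ [] = []
toList-⊑ (a≤b ∷ u⊑v) = a≤b ∷ toList-⊑ u⊑v

tail-maximal : ∀ k ks → Gaps (k ∷ ks) → (v : Vec Bool n) → IsFib (true ∷ v) →
               gapString k ks ⊑ᴸ toList v → toList v ≡ gapString k ks
tail-maximal 0 [] _ [] _ [] = refl
tail-maximal 0 (_ ∷ _) ((() , _) , _) _ _ _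
tail-maximal 1 [] _ (false ∷ []) _ _ = refl
tail-maximal 1 [] _ (true ∷ []) (() , _) _
tail-maximal 1 [] _ (_ ∷ _ ∷ _) _ (_ ∷ ())
tail-maximal 1 (k ∷ ks) (_ , gaps) (false ∷ true ∷ v) (_ , _ , fib) (_ ∷ _ ∷ ks⊑v) =
  cong (λ z → false ∷ true ∷ z) (tail-maximal k ks gaps v fib ks⊑v)
tail-maximal 1 (k ∷ ks) _ (true ∷ _) (() , _) _
tail-maximal 1 (k ∷ ks) _ (false ∷ false ∷ _) _ (_ ∷ () ∷ _)
tail-maximal 2 [] (s≤s ()) _ _ _
tail-maximal 2 (k ∷ ks) (_ , gaps) (false ∷ false ∷ true ∷ v) (_ , _ , _ , fib) (_ ∷ _ ∷ _ ∷ ks⊑v) =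
  cong (λ z → false ∷ false ∷ true ∷ z) (tail-maximal k ks gaps v fib ks⊑v)
tail-maximal 2 (k ∷ ks) _ (true ∷ _) (() , _) _
tail-maximal 2 (k ∷ ks) _ (false ∷ true ∷ true ∷ _) (_ , _ , () , _) _
tail-maximal 2 (k ∷ ks) _ (false ∷ _ ∷ false ∷ _) _ (_ ∷ _ ∷ () ∷ _)
tail-maximal 2 (k ∷ ks) _ (_ ∷ _ ∷ []) _ (_ ∷ _ ∷ ())
tail-maximal (suc (suc (suc _))) [] (s≤s ()) _ _ _
tail-maximal (suc (suc (suc _))) (_ ∷ _) ((_ , s≤s (s≤s ())) , _) _ _ _

gapString-maximal : ∀ l₀ ks → l₀ ≤ 1 → Gaps ks → ¬ (l₀ ≡ 1 × ks ≡ []) →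
                    (v : Vec Bool n) → IsFib v → gapString l₀ ks ⊑ᴸ toList v → toList v ≡ gapString l₀ ks
gapString-maximal 0 [] _ _ _ [] _ [] = refl
gapString-maximal 0 (k ∷ ks) _ gaps _ (true ∷ v) fib (_ ∷ ks⊑v) =
  cong (true ∷_) (tail-maximal k ks gaps v fib ks⊑v)
gapString-maximal 0 (k ∷ ks) _ _ _ (false ∷ _) _ (() ∷ _)
gapString-maximal 1 [] _ _ not-single-zero _ _ _ = ⊥-elim (not-single-zero (refl , refl))
gapString-maximal 1 (k ∷ ks) _ gaps _ (false ∷ true ∷ v) (_ , fib) (_ ∷ _ ∷ ks⊑v) =
  cong (λ z → false ∷ true ∷ z) (tail-maximal k ks gaps v fib ks⊑v)
gapString-maximal 1 (k ∷ ks) _ _ _ (true ∷ true ∷ _) (() , _) _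
gapString-maximal 1 (k ∷ ks) _ _ _ (_ ∷ false ∷ _) _ (_ ∷ () ∷ _)
gapString-maximal 1 (k ∷ ks) _ _ _ (_ ∷ []) _ (_ ∷ ())
gapString-maximal (suc (suc _)) _ (s≤s ()) _ _ _ _ _

tail-fib : ∀ k ks → Gaps (k ∷ ks) → IsFib (fromList (true ∷ gapString k ks))
tail-fib 0 [] _ = tt
tail-fib 0 (_ ∷ _) ((() , _) , _)
tail-fib 1 [] _ = refl , tt
tail-fib 1 (k ∷ ks) (_ , gaps) = refl , refl , tail-fib k ks gaps
tail-fib 2 [] (s≤s ())
tail-fib 2 (k ∷ ks) (_ , gaps) = refl , refl , refl , tail-fib k ks gaps
tail-fib (suc (suc (suc _))) [] (s≤s ())
tail-fib (suc (suc (suc _))) (_ ∷ _) ((_ , s≤s (s≤s ())) , _)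

gapString-fib : ∀ l₀ ks → l₀ ≤ 1 → Gaps ks → IsFib (fromList (gapString l₀ ks))
gapString-fib 0 [] _ _ = tt
gapString-fib 0 (k ∷ ks) _ gaps = tail-fib k ks gaps
gapString-fib 1 [] _ _ = tt
gapString-fib 1 (k ∷ ks) _ gaps = refl , tail-fib k ks gaps
gapString-fib (suc (suc _)) _ (s≤s ()) _

weight-toList : (v : Vec Bool n) → weight (fromList (toList v)) ≡ weight v
weight-toList [] = refl
weight-toList (true ∷ v) = cong suc (weight-toList v)
weight-toList (false ∷ v) = weight-toList v

IsFib-toList : (v : Vec Bool n) → IsFib (fromList (toList v)) → IsFib v
IsFib-toList [] _ = tt
IsFib-toList (_ ∷ []) _ = tt
IsFib-toList (_ ∷ c ∷ v) (e , fib) = e , IsFib-toList (c ∷ v) fib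

weight-gapString : ∀ l₀ ks → weight (fromList (gapString l₀ ks)) ≡ length ks
weight-gapString (suc l₀) ks = weight-gapString l₀ ks
weight-gapString 0 [] = refl
weight-gapString 0 (k ∷ ks) = cong suc (weight-gapString k ks)

length-gapString : ∀ l₀ ks → length (gapString l₀ ks) ≡ l₀ + Vec.sum (fromList ks) + length ks
length-gapString (suc l₀) ks = cong suc (length-gapString l₀ ks)
length-gapString 0 [] = refl
length-gapString 0 (k ∷ ks) = begin
  suc (length (gapString k ks))                ≡⟨ cong suc (length-gapString k ks) ⟩
  suc (k + Vec.sum (fromList ks) + length ks)  ≡⟨ +-suc _ (length ks) ⟨
  k + Vec.sum (fromList ks) + suc (length ks)  ∎
  where open ≡-Reasoning

InnerGaps : Vec ℕ (suc p) → Set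
InnerGaps {p} l = ∀ (i : Fin (suc p)) → 1 ≤ toℕ i → toℕ i < p → 1 ≤ lookup l i × lookup l i ≤ 2

last-gap : ∀ k ks → Gaps (k ∷ ks) → Vec.last (k ∷ fromList ks) ≤ 1
last-gap k [] k≤1 = k≤1
last-gap k (k′ ∷ ks) (_ , gaps) = last-gap k′ ks gaps

inner-gaps : ∀ l₀ ks → Gaps ks → InnerGaps (l₀ ∷ fromList ks)
inner-gaps l₀ ks gaps (Fin.suc j) _ j<len = middle ks gaps j j<len
  where
  middle : ∀ ks → Gaps ks → (j : Fin (length ks)) → suc (toℕ j) < length ks →
           1 ≤ lookup (fromList ks) j × lookup (fromList ks) j ≤ 2
  middle (_ ∷ []) _ Fin.zero (s≤s ())
  middle (_ ∷ _ ∷ _) (k-gap , _) Fin.zero _ = k-gap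
  middle (_ ∷ k′ ∷ ks) (_ , gaps) (Fin.suc j) (s≤s j<len) = middle (k′ ∷ ks) gaps j j<len

gaps-of-TopForm : ∀ l₀ (ls : Vec ℕ p) → Vec.last (l₀ ∷ ls) ≤ 1 → InnerGaps (l₀ ∷ ls) → Gaps (toList ls)
gaps-of-TopForm _ [] _ _ = tt
gaps-of-TopForm _ (_ ∷ []) last≤1 _ = last≤1
gaps-of-TopForm _ (k ∷ k′ ∷ ls) last≤1 inner =
  inner (Fin.suc Fin.zero) (s≤s z≤n) (s≤s (s≤s z≤n)) ,
  gaps-of-TopForm k (k′ ∷ ls) last≤1 (λ i 1≤i i<p → inner (Fin.suc i) (s≤s z≤n) (s≤s i<p))

gapForm⇒TopForm : (t : Vec Bool n) → GapForm t → TopForm n (weight t) t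
gapForm⇒TopForm {n} t (l₀ , ks , l₀≤1 , gaps , t≡) =
  subst (λ p → TopForm n p t) (sym weight≡)
    (l₀ ∷ fromList ks , sum≡ , l₀≤1 , last≤1 , inner-gaps l₀ ks gaps , shape)
  where
  weight≡ : weight t ≡ length ks
  weight≡ = trans (sym (weight-toList t)) (trans (cong (weight ∘ fromList) t≡) (weight-gapString l₀ ks))
  n≡ : n ≡ l₀ + Vec.sum (fromList ks) + length ks
  n≡ = trans (sym (VecP.length-toList t)) (trans (cong length t≡) (length-gapString l₀ ks))
  sum≡ : Vec.sum (l₀ ∷ fromList ks) ≡ n ∸ length ks
  sum≡ = trans (sym (m+n∸n≡m _ (length ks))) (cong (_∸ length ks) (sym n≡))
  last≤1 : Vec.last (l₀ ∷ fromList ks) ≤ 1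
  last≤1 = last-gap₀ ks gaps
    where
    last-gap₀ : ∀ ks → Gaps ks → Vec.last (l₀ ∷ fromList ks) ≤ 1
    last-gap₀ [] _ = l₀≤1
    last-gap₀ (k ∷ ks) gaps = last-gap k ks gaps
  shape : toList t ≡ topList (l₀ ∷ fromList ks)
  shape = trans t≡ (cong (gapString l₀) (sym (VecP.toList∘fromList ks)))

-- The string 0 has the gap form but is not maximal: 1 lies above it.
single-zero-excluded : ∀ l₀ (ls : Vec ℕ p) → Vec.sum (l₀ ∷ ls) ≡ n ∸ p → ¬ (p ≡ 0 × n ≡ 1) →
                       ¬ (l₀ ≡ 1 × toList ls ≡ [])
single-zero-excluded _ [] sum≡ not-exception (refl , _) = not-exception (refl , sym sum≡)
single-zero-excluded _ (_ ∷ _) _ _ (_ , ())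

TopForm⇒maximalFib : (t : Vec Bool n) → TopForm n p t → ¬ (p ≡ 0 × n ≡ 1) →
                     IsFib t × weight t ≡ p × MaximalFib t
TopForm⇒maximalFib {p = p} t (l₀ ∷ ls , sum≡ , l₀≤1 , last≤1 , inner , shape) not-exception =
  t-fib , weight≡ , maximal
  where
  gaps = gaps-of-TopForm l₀ ls last≤1 inner
  t-fib : IsFib t
  t-fib = IsFib-toList t (subst (IsFib ∘ fromList) (sym shape) (gapString-fib l₀ (toList ls) l₀≤1 gaps))
  weight≡ : weight t ≡ p
  weight≡ = trans (sym (weight-toList t))
            (trans (cong (weight ∘ fromList) shape)
            (trans (weight-gapString l₀ (toList ls)) (VecP.length-toList ls)))
  maximal : MaximalFib t
  maximal v fib-v t⊑v = trans (sym (cast-is-id refl v)) (VecP.toList-injective refl v t (trans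
    (gapString-maximal l₀ (toList ls) l₀≤1 gaps (single-zero-excluded l₀ ls sum≡ not-exception)
      v fib-v (subst (_⊑ᴸ toList v) shape (toList-⊑ t⊑v)))
    (sym shape)))

maximalFib⇒gapForm : (t : Vec Bool n) → IsFib t → MaximalFib t → GapForm t
maximalFib⇒gapForm t t-fib t-maximal with gapForm-or-enlargeable t t-fib
... | inj₁ form = form
... | inj₂ (v , v-fib , t⊑v , v≢t) = ⊥-elim (v≢t (t-maximal v v-fib t⊑v))

downsets-SameCube : (H : Cube n p) (H′ : Cube n q) {t : Vec Bool n} →
                    (_∈C H) ≐ (_⊑ t) → (_∈C H′) ≐ (_⊑ t) → SameCube H H′
downsets-SameCube _ _ (H⊆ , ⊆H) (H′⊆ , ⊆H′) _ = mk⇔ (⊆H′ ∘ H⊆) (⊆H ∘ H′⊆)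

lemma1 : (n p : ℕ) →
    ( ((H : Cube n p) → Maximal H →
        IsBottom H (replicate n false) × (Σ[ t ∈ Vec Bool n ] (IsTop H t × TopForm n p t)))
    × ((t : Vec Bool n) → TopForm n p t → ¬ (p ≡ 0 × n ≡ 1) →
        Σ[ H ∈ Cube n p ] (Maximal H × IsTop H t
          × ((q : ℕ) (H' : Cube n q) → Maximal H' → IsTop H' t → SameCube H H'))) )
lemma1 n p = maximal⇒form , form⇒maximal
  where
  maximal⇒form : (H : Cube n p) → Maximal H →
                 IsBottom H (replicate n false) × (Σ[ t ∈ Vec Bool n ] (IsTop H t × TopForm n p t))
  maximal⇒form H maximal with maximal-cube-downset H maximal
  ... | t , t-fib , refl , t-maximal , H≐ =
    downset-IsBottom H H≐ , t , downset-IsTop H H≐ , gapForm⇒TopForm t (maximalFib⇒gapForm t t-fib t-maximal)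

  form⇒maximal : (t : Vec Bool n) → TopForm n p t → ¬ (p ≡ 0 × n ≡ 1) →
                 Σ[ H ∈ Cube n p ] (Maximal H × IsTop H t
                   × ((q : ℕ) (H' : Cube n q) → Maximal H' → IsTop H' t → SameCube H H'))
  form⇒maximal t form not-exception with TopForm⇒maximalFib t form not-exception
  ... | t-fib , weight≡p , t-maximal with downset-cube t t-fib weight≡p
  ... | H , H≐ = H , downset-maximal t-maximal weight≡p H H≐ , downset-IsTop H H≐ , unique
    where
    unique : (q : ℕ) (H′ : Cube n q) → Maximal H′ → IsTop H′ t → SameCube H H′
    unique _ H′ maximal′ t-top′ with maximal-cube-downset H′ maximal′
    ... | _ , _ , _ , _ , H′≐ with IsTop-unique H′ (downset-IsTop H′ H′≐) t-top′
    ... | refl = downsets-SameCube H H′ H≐ H′≐
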